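{- The graph $F(9,15,22)$ on vertex set $\{1,\dots,9\}$ with edges $\{4,6\},\{1,4\},\{1,2\},\{2,3\},\{5,6\},\{1,3\},\{4,5\},\{2,5\},\{2,8\},\{2,7\},\{7,8\},\{3,8\},\{4,9\},\{6,9\},\{7,9\}$ is forbidden.
   Context: All graphs are finite and simple. A graph $G$ with vertex set $V$ is unit-distance if there exists an injective map $\varphi\colon V\to\mathbf{R}^2$ with $|\varphi(v)-\varphi(w)|=1$ for every pair of adjacent vertices $v,w$ (non-adjacent vertices may also be at distance 1). A graph is forbidden if it is not unit-distance. -}

module Defs where

open import Level using (0ℓ)
open import Data.Nat using (ℕ)
open import Data.Fin using (Fin; zero; suc)
open import Data.Fin.Patterns using (0F; 1F; 2F; 3F; 4F; 5F; 6F; 7F; 8F)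
open import Data.Product using (Σ; ∃; _×_; _,_)
open import Data.Sum using (_⊎_)
open import Data.List using (List; []; _∷_)
open import Data.List.Membership.Propositional using (_∈_)
open import Relation.Binary.PropositionalEquality using (_≡_)
open import Relation.Nullary using (¬_)
open import Algebra.Structures using (IsCommutativeRing)
open import Function.Definitions using (Injective)

-- The real numbers, axiomatised as a complete ordered field
-- (any two models are isomorphic, so quantifying over all models
-- is the same as speaking about ℝ).

record RealField : Set₁ where
  infixl 6 _+_ _-_
  infixl 7 _*_
  infix 4 _<_ _≤_
  field
    R   : Set
    _+_ : R → R → R
    _*_ : R → R → R
    -_  : R → R
    0#  : R
    1#  : R
    isCommutativeRing : IsCommutativeRing _≡_ _+_ _*_ -_ 0# 1#
    0≢1 : ¬ (0# ≡ 1#)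
    inverse : ∀ x → ¬ (x ≡ 0#) → Σ R (λ y → x * y ≡ 1#)
    _<_ : R → R → Set
    <-irrefl : ∀ x → ¬ (x < x)
    <-trans : ∀ {x y z} → x < y → y < z → x < z
    <-trichotomy : ∀ x y → (x < y) ⊎ ((x ≡ y) ⊎ (y < x))
    +-mono-< : ∀ {x y} z → x < y → x + z < y + z
    *-pos : ∀ {x y} → 0# < x → 0# < y → 0# < x * y

  _≤_ : R → R → Set
  x ≤ y = (x < y) ⊎ (x ≡ y)

  _-_ : R → R → R
  x - y = x + (- y)

  IsUpperBound : (R → Set) → R → Set
  IsUpperBound S b = ∀ x → S x → x ≤ b

  field
    completeness : (S : R → Set) → ∃ S → ∃ (IsUpperBound S) →
                   ∃ (λ s → IsUpperBound S s × (∀ b → IsUpperBound S b → s ≤ b))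

record Graph (n : ℕ) : Set where
  field
    edges : List (Fin n × Fin n)

module _ (ℝ : RealField) where
  open RealField ℝ

  Point : Set
  Point = R × R

  dist² : Point → Point → R
  dist² (x₁ , y₁) (x₂ , y₂) = (x₁ - x₂) * (x₁ - x₂) + (y₁ - y₂) * (y₁ - y₂)

  -- |p - q| = 1  iff  |p - q|² = 1 (distances are non-negative)
  IsUnitDistanceEmbedding : ∀ {n} → Graph n → (Fin n → Point) → Set
  IsUnitDistanceEmbedding {n} G φ =
    Injective _≡_ _≡_ φ ×
    (∀ {v w} → (v , w) ∈ Graph.edges G → dist² (φ v) (φ w) ≡ 1#)

  UnitDistance : ∀ {n} → Graph n → Set
  UnitDistance {n} G = ∃ (λ (φ : Fin n → Point) → IsUnitDistanceEmbedding G φ)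

  Forbidden : ∀ {n} → Graph n → Set
  Forbidden G = ¬ UnitDistance G

-- F(9,15,22); vertex k of the paper is (k - 1) : Fin 9.

F-9-15-22 : Graph 9
F-9-15-22 = record { edges =
    (3F , 5F) ∷ (0F , 3F) ∷ (0F , 1F) ∷ (1F , 2F) ∷ (4F , 5F) ∷ (0F , 2F) ∷ (3F , 4F) ∷
    (1F , 4F) ∷ (1F , 7F) ∷ (1F , 6F) ∷ (6F , 7F) ∷ (2F , 7F) ∷ (3F , 8F) ∷ (5F , 8F) ∷
    (6F , 8F) ∷ [] }

module Submission where

-- The argument is purely algebraic.  Its geometric core is the rhombus
-- lemma: if two distinct points U, V are at the same distance from two
-- distinct points X, Y, then XUYV is a rhombus, i.e. U + V = X + Y.
-- Four rhombi of F(9,15,22) force the images of vertices 5 and 6 to be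
-- integer combinations of the images of 1, 3, 4 and 8.  The remaining
-- unit edges 1–4, 3–4, 3–8, 3–5 and 6–8 then contradict a polynomial
-- identity: a certain square equals an integer combination of their
-- squared lengths, which would evaluate to 2 + 2 + 2 - 6 - 3 = -3.

open import Defs
open import Data.Nat as ℕ using (ℕ; zero; suc)
import Data.Nat.Properties as ℕP
open import Data.Integer as ℤ using (ℤ; +_; -[1+_]; sign; ∣_∣)
import Data.Integer.Properties as ℤP
open import Data.Sign as Sign using (Sign)
open import Data.Maybe using (Maybe; just; nothing)
open import Data.Product using (_,_; proj₁; proj₂)
open import Data.Sum using (_⊎_; inj₁; inj₂)
open import Data.List.Membership.Propositional using (_∈_)
open import Data.Empty using (⊥; ⊥-elim)
open import Data.Fin as Fin using (Fin)
open import Data.Fin.Patterns using (0F; 1F; 2F; 3F; 4F; 5F; 6F; 7F; 8F)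
import Data.Product.Properties as ProdP
open import Algebra.Bundles using (CommutativeRing)
open import Algebra.Solver.Ring.AlmostCommutativeRing
  using (_-Raw-AlmostCommutative⟶_; fromCommutativeRing)
open import Relation.Binary.PropositionalEquality
  using (_≡_; _≢_; refl; sym; trans; cong; cong₂; subst; subst₂; module ≡-Reasoning)
open import Relation.Nullary using (Dec; yes; no)
open import Relation.Nullary.Decidable using (True; False; toWitness; toWitnessFalse; _⊎-dec_)

module IntegerCoefficients {c ℓ} (CR : CommutativeRing c ℓ) where
  open CommutativeRing CR renaming (refl to ≈-refl; sym to ≈-sym; trans to ≈-trans)
  open import Algebra.Properties.Ring ring
    using (-‿involutive; -0#≈0#; -‿distribˡ-*; -‿distribʳ-*; -‿+-comm)
  open import Algebra.Properties.CommutativeSemigroup +-commutativeSemigroup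
    using () renaming (interchange to +-interchange)
  open import Algebra.Properties.Semiring.Mult semiring using (_×_; ×-homo-+; ×1-homo-*)
  open import Relation.Binary.Reasoning.Setoid setoid

  ⟦_⟧ℤ : ℤ → Carrier
  ⟦ + n ⟧ℤ      = n × 1#
  ⟦ -[1+ n ] ⟧ℤ = - (suc n × 1#)

  signed : Sign → Carrier → Carrier
  signed Sign.+ x = x
  signed Sign.- x = - x

  signed-cong : ∀ s {x y} → x ≈ y → signed s x ≈ signed s y
  signed-cong Sign.+ x≈y = x≈y
  signed-cong Sign.- x≈y = -‿cong x≈y

  signed-* : ∀ s t x y → signed (s Sign.* t) (x * y) ≈ signed s x * signed t y
  signed-* Sign.+ Sign.+ x y = ≈-refl
  signed-* Sign.+ Sign.- x y = -‿distribʳ-* x y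
  signed-* Sign.- Sign.+ x y = -‿distribˡ-* x y
  signed-* Sign.- Sign.- x y = begin
    x * y          ≈⟨ -‿involutive (x * y) ⟨
    - - (x * y)    ≈⟨ -‿cong (-‿distribˡ-* x y) ⟩
    - (- x * y)    ≈⟨ -‿distribʳ-* (- x) y ⟩
    - x * - y      ∎

  ⟦◃⟧ : ∀ s n → ⟦ s ℤ.◃ n ⟧ℤ ≈ signed s (n × 1#)
  ⟦◃⟧ Sign.+ zero    = ≈-refl
  ⟦◃⟧ Sign.- zero    = ≈-sym -0#≈0#
  ⟦◃⟧ Sign.+ (suc n) = ≈-refl
  ⟦◃⟧ Sign.- (suc n) = ≈-refl

  ⟦⟧-signed : ∀ i → signed (sign i) (∣ i ∣ × 1#) ≈ ⟦ i ⟧ℤ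
  ⟦⟧-signed (+ n)    = ≈-refl
  ⟦⟧-signed -[1+ n ] = ≈-refl

  -- Integer multiplication multiplies signs and absolute values separately.
  *-homo : ∀ i j → ⟦ i ℤ.* j ⟧ℤ ≈ ⟦ i ⟧ℤ * ⟦ j ⟧ℤ
  *-homo i j = begin
    ⟦ i ℤ.* j ⟧ℤ
      ≈⟨ ⟦◃⟧ (sign i Sign.* sign j) (∣ i ∣ ℕ.* ∣ j ∣) ⟩
    signed (sign i Sign.* sign j) ((∣ i ∣ ℕ.* ∣ j ∣) × 1#)
      ≈⟨ signed-cong (sign i Sign.* sign j) (×1-homo-* ∣ i ∣ ∣ j ∣) ⟩
    signed (sign i Sign.* sign j) ((∣ i ∣ × 1#) * (∣ j ∣ × 1#))
      ≈⟨ signed-* (sign i) (sign j) _ _ ⟩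
    signed (sign i) (∣ i ∣ × 1#) * signed (sign j) (∣ j ∣ × 1#)
      ≈⟨ *-cong (⟦⟧-signed i) (⟦⟧-signed j) ⟩
    ⟦ i ⟧ℤ * ⟦ j ⟧ℤ ∎

  cancel-1 : ∀ a b → (1# + a) - (1# + b) ≈ a - b
  cancel-1 a b = begin
    (1# + a) + - (1# + b)    ≈⟨ +-congˡ (-‿+-comm 1# b) ⟨
    (1# + a) + (- 1# + - b)  ≈⟨ +-interchange 1# a (- 1#) (- b) ⟩
    (1# - 1#) + (a - b)      ≈⟨ +-congʳ (-‿inverseʳ 1#) ⟩
    0# + (a - b)             ≈⟨ +-identityˡ (a - b) ⟩
    a - b                    ∎

  ⊖-homo : ∀ m n → ⟦ m ℤ.⊖ n ⟧ℤ ≈ m × 1# - n × 1#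
  ⊖-homo zero zero = ≈-sym (-‿inverseʳ 0#)
  ⊖-homo (suc m) zero = begin
    ⟦ suc m ℤ.⊖ 0 ⟧ℤ         ≡⟨ cong ⟦_⟧ℤ (ℤP.⊖-≥ {suc m} {0} ℕ.z≤n) ⟩
    suc m × 1#              ≈⟨ +-identityʳ _ ⟨
    suc m × 1# + 0#         ≈⟨ +-congˡ -0#≈0# ⟨
    suc m × 1# - 0#         ∎
  ⊖-homo zero (suc n) = begin
    ⟦ 0 ℤ.⊖ suc n ⟧ℤ         ≡⟨ cong ⟦_⟧ℤ (ℤP.⊖-≤ {0} {suc n} ℕ.z≤n) ⟩
    - (suc n × 1#)          ≈⟨ +-identityˡ _ ⟨
    0# - suc n × 1#         ∎
  ⊖-homo (suc m) (suc n) = begin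
    ⟦ suc m ℤ.⊖ suc n ⟧ℤ      ≡⟨ cong ⟦_⟧ℤ (ℤP.[1+m]⊖[1+n]≡m⊖n m n) ⟩
    ⟦ m ℤ.⊖ n ⟧ℤ             ≈⟨ ⊖-homo m n ⟩
    m × 1# - n × 1#          ≈⟨ cancel-1 (m × 1#) (n × 1#) ⟨
    suc m × 1# - suc n × 1#  ∎

  +-homo : ∀ i j → ⟦ i ℤ.+ j ⟧ℤ ≈ ⟦ i ⟧ℤ + ⟦ j ⟧ℤ
  +-homo (+ m)    (+ n)    = ×-homo-+ 1# m n
  +-homo (+ m)    -[1+ n ] = ⊖-homo m (suc n)
  +-homo -[1+ m ] (+ n)    = ≈-trans (⊖-homo n (suc m)) (+-comm _ _)
  +-homo -[1+ m ] -[1+ n ] = begin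
    - (suc (suc (m ℕ.+ n)) × 1#)     ≡⟨ cong (λ k → - (k × 1#)) (ℕP.+-suc (suc m) n) ⟨
    - ((suc m ℕ.+ suc n) × 1#)       ≈⟨ -‿cong (×-homo-+ 1# (suc m) (suc n)) ⟩
    - (suc m × 1# + suc n × 1#)      ≈⟨ -‿+-comm _ _ ⟨
    - (suc m × 1#) + - (suc n × 1#)  ∎

  -‿homo : ∀ i → ⟦ ℤ.- i ⟧ℤ ≈ - ⟦ i ⟧ℤ
  -‿homo (+ zero)  = ≈-sym -0#≈0#
  -‿homo (+ suc n) = ≈-refl
  -‿homo -[1+ n ]  = ≈-sym (-‿involutive _)

  integerMorphism : ℤ.+-*-rawRing -Raw-AlmostCommutative⟶ fromCommutativeRing CR
  integerMorphism = record
    { ⟦_⟧ = ⟦_⟧ℤ ; +-homo = +-homo ; *-homo = *-homo ; -‿homo = -‿homo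
    ; 0-homo = ≈-refl ; 1-homo = +-identityʳ 1# }

  coefficient≟ : ∀ i j → Maybe (⟦ i ⟧ℤ ≈ ⟦ j ⟧ℤ)
  coefficient≟ i j with i ℤ.≟ j
  ... | yes i≡j = just (reflexive (cong ⟦_⟧ℤ i≡j))
  ... | no _    = nothing

  open import Algebra.Solver.Ring ℤ.+-*-rawRing (fromCommutativeRing CR) integerMorphism coefficient≟
    public

-- Instantiated with the
-- real numbers they state identities; instantiated with solver
-- polynomials they are the expressions the solver normalises.

module Vectors {a} {A : Set a} (_+_ _*_ : A → A → A) (-_ : A → A) where
  open import Data.Product using (_×_)

  infixl 6 _⊕_ _⊖_
  infix  8 _·_ _∧_

  Vector : Set a
  Vector = A × A

  _⊕_ : Vector → Vector → Vector
  (u₁ , u₂) ⊕ (v₁ , v₂) = (u₁ + v₁ , u₂ + v₂)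

  _⊖_ : Vector → Vector → Vector
  (u₁ , u₂) ⊖ (v₁ , v₂) = (u₁ + (- v₁) , u₂ + (- v₂))

  _·_ : Vector → Vector → A
  (u₁ , u₂) · (v₁ , v₂) = (u₁ * v₁) + (u₂ * v₂)

  _∧_ : Vector → Vector → A
  (u₁ , u₂) ∧ (v₁ , v₂) = (u₁ * v₂) + (- (u₂ * v₁))

  ‖_‖² : Vector → A
  ‖ u ‖² = u · u

  -- For a quadrilateral XUYV: its diagonals, and the vector (U + V) - (X + Y),
  -- which is twice the offset between the midpoints of the diagonals.
  module Quadrilateral (X Y U V : Vector) where
    diagonalXY : Vector
    diagonalXY = Y ⊖ X

    diagonalUV : Vector
    diagonalUV = V ⊖ U

    midpointOffset : Vector
    midpointOffset = (U ⊕ V) ⊖ (X ⊕ Y)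

module PlaneGeometry (ℝ : RealField) where
  open RealField ℝ

  commutativeRing : CommutativeRing _ _
  commutativeRing = record { isCommutativeRing = isCommutativeRing }

  open CommutativeRing commutativeRing
    using (+-comm; +-identityˡ; +-identityʳ; *-identityʳ; *-assoc; zeroˡ; zeroʳ;
           distribˡ; -‿inverseʳ; ring; semiring)
  open import Algebra.Properties.Ring ring using (x∙y⁻¹≈ε⇒x≈y)
  open import Algebra.Properties.Semiring.Mult semiring using (_×_)
  open IntegerCoefficients commutativeRing
    using (Polynomial; solve; _:=_; _:+_; _:*_; :-_; _:-_; _:×_; con)
  open Vectors _+_ _*_ -_ public
  module Syntax {n : ℕ} = Vectors {A = Polynomial n} _:+_ _:*_ :-_
  open Syntax using () renaming
    (_⊕_ to _⊕ₚ_; _⊖_ to _⊖ₚ_; _·_ to _·ₚ_; _∧_ to _∧ₚ_; ‖_‖² to ‖_‖²ₚ;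
     module Quadrilateral to Quadrilateralₚ)
  open ≡-Reasoning

  positive-nonzero : ∀ {x} → 0# < x → x ≢ 0#
  positive-nonzero 0<x x≡0 = <-irrefl 0# (subst (0# <_) x≡0 0<x)

  _≟0 : ∀ x → Dec (x ≡ 0#)
  x ≟0 with <-trichotomy x 0#
  ... | inj₁ x<0        = no λ x≡0 → <-irrefl 0# (subst (_< 0#) x≡0 x<0)
  ... | inj₂ (inj₁ x≡0) = yes x≡0
  ... | inj₂ (inj₂ 0<x) = no (positive-nonzero 0<x)

  negate-negative : ∀ {x} → x < 0# → 0# < - x
  negate-negative {x} x<0 =
    subst₂ _<_ (-‿inverseʳ x) (+-identityˡ (- x)) (+-mono-< (- x) x<0)

  square-pos : ∀ x → x ≢ 0# → 0# < x * x
  square-pos x x≢0 with <-trichotomy 0# x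
  ... | inj₁ 0<x        = *-pos 0<x 0<x
  ... | inj₂ (inj₁ 0≡x) = ⊥-elim (x≢0 (sym 0≡x))
  ... | inj₂ (inj₂ x<0) =
    subst (0# <_) (neg*neg x) (*-pos (negate-negative x<0) (negate-negative x<0))
    where
    neg*neg : ∀ x → - x * - x ≡ x * x
    neg*neg = solve 1 (λ x → :- x :* :- x := x :* x) refl

  square-nonneg : ∀ x → 0# ≤ x * x
  square-nonneg x with x ≟0
  ... | yes refl = inj₂ (sym (zeroˡ 0#))
  ... | no x≢0   = inj₁ (square-pos x x≢0)

  +-pos : ∀ {x y} → 0# < x → 0# ≤ y → 0# < x + y
  +-pos {x} {y} 0<x (inj₁ 0<y) =
    <-trans 0<x (subst₂ _<_ (+-identityˡ x) (+-comm y x) (+-mono-< x 0<y))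
  +-pos {x} 0<x (inj₂ refl) = subst (0# <_) (sym (+-identityʳ x)) 0<x

  +-nonneg : ∀ {x y} → 0# ≤ x → 0# ≤ y → 0# ≤ x + y
  +-nonneg (inj₁ 0<x) 0≤y = inj₁ (+-pos 0<x 0≤y)
  +-nonneg {y = y} (inj₂ refl) 0≤y = subst (0# ≤_) (sym (+-identityˡ y)) 0≤y

  0<1 : 0# < 1#
  0<1 = subst (0# <_) (*-identityʳ 1#) (square-pos 1# (λ 1≡0 → 0≢1 (sym 1≡0)))

  multiple-pos : ∀ n → 0# < suc n × 1#
  multiple-pos zero    = subst (0# <_) (sym (+-identityʳ 1#)) 0<1
  multiple-pos (suc n) = +-pos 0<1 (inj₁ (multiple-pos n))

  positive-shift : ∀ {y s} → 0# < y → y + s ≢ s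
  positive-shift {y} {s} 0<y y+s≡s =
    <-irrefl s (subst₂ _<_ (+-identityˡ s) y+s≡s (+-mono-< s 0<y))

  sum-of-squares-zero : ∀ x y → x * x + y * y ≡ 0# → x ≡ 0#
  sum-of-squares-zero x y s≡0 with x ≟0
  ... | yes x≡0 = x≡0
  ... | no x≢0  = ⊥-elim (positive-nonzero (+-pos (square-pos x x≢0) (square-nonneg y)) s≡0)

  cancel-nonzero : ∀ x z → x * z ≡ 0# → z ≢ 0# → x ≡ 0#
  cancel-nonzero x z xz≡0 z≢0 with inverse z z≢0
  ... | z⁻¹ , zz⁻¹≡1 = begin
    x              ≡⟨ sym (*-identityʳ x) ⟩
    x * 1#         ≡⟨ cong (x *_) (sym zz⁻¹≡1) ⟩
    x * (z * z⁻¹)  ≡⟨ sym (*-assoc x z z⁻¹) ⟩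
    (x * z) * z⁻¹  ≡⟨ cong (_* z⁻¹) xz≡0 ⟩
    0# * z⁻¹       ≡⟨ zeroˡ z⁻¹ ⟩
    0#             ∎

  -- The characteristic is not 2: x + x = 0 forces x * x + x * x = 0.
  double-zero : ∀ x → x + x ≡ 0# → x ≡ 0#
  double-zero x x+x≡0 =
    sum-of-squares-zero x x (trans (sym (distribˡ x x x)) (trans (cong (x *_) x+x≡0) (zeroʳ x)))

  norm-nonneg : ∀ u → 0# ≤ ‖ u ‖²
  norm-nonneg (u₁ , u₂) = +-nonneg (square-nonneg u₁) (square-nonneg u₂)

  norm-zero : ∀ u → ‖ u ‖² ≡ 0# → u ≡ (0# , 0#)
  norm-zero (u₁ , u₂) ‖u‖²≡0 =
    cong₂ _,_ (sum-of-squares-zero u₁ u₂ ‖u‖²≡0)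
              (sum-of-squares-zero u₂ u₁ (trans (+-comm _ _) ‖u‖²≡0))

  difference-zero : ∀ P Q → P ⊖ Q ≡ (0# , 0#) → P ≡ Q
  difference-zero (p₁ , p₂) (q₁ , q₂) P⊖Q≡0 =
    cong₂ _,_ (x∙y⁻¹≈ε⇒x≈y p₁ q₁ (cong proj₁ P⊖Q≡0)) (x∙y⁻¹≈ε⇒x≈y p₂ q₂ (cong proj₂ P⊖Q≡0))

  separated : ∀ {P Q} → P ≢ Q → ‖ P ⊖ Q ‖² ≢ 0#
  separated {P} {Q} P≢Q ‖P⊖Q‖²≡0 = P≢Q (difference-zero P Q (norm-zero (P ⊖ Q) ‖P⊖Q‖²≡0))

  dist²-sym : ∀ P Q → dist² ℝ P Q ≡ dist² ℝ Q P
  dist²-sym (p₁ , p₂) (q₁ , q₂) = solve 4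
    (λ p₁ p₂ q₁ q₂ → let P = (p₁ , p₂) ; Q = (q₁ , q₂) in ‖ P ⊖ₚ Q ‖²ₚ := ‖ Q ⊖ₚ P ‖²ₚ)
    refl p₁ p₂ q₁ q₂

  lagrange : ∀ u v → ‖ u ‖² * ‖ v ‖² ≡ (u · v) * (u · v) + (u ∧ v) * (u ∧ v)
  lagrange (u₁ , u₂) (v₁ , v₂) = solve 4
    (λ u₁ u₂ v₁ v₂ → let u = (u₁ , u₂) ; v = (v₁ , v₂) in
       ‖ u ‖²ₚ :* ‖ v ‖²ₚ := (u ·ₚ v) :* (u ·ₚ v) :+ (u ∧ₚ v) :* (u ∧ₚ v))
    refl u₁ u₂ v₁ v₂

  cramer₁ : ∀ e w m → proj₁ m * (e ∧ w) ≡ (m · e) * proj₂ w - (m · w) * proj₂ e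
  cramer₁ (e₁ , e₂) (w₁ , w₂) (m₁ , m₂) = solve 6
    (λ e₁ e₂ w₁ w₂ m₁ m₂ → let e = (e₁ , e₂) ; w = (w₁ , w₂) ; m = (m₁ , m₂) in
       m₁ :* (e ∧ₚ w) := (m ·ₚ e) :* w₂ :- (m ·ₚ w) :* e₂)
    refl e₁ e₂ w₁ w₂ m₁ m₂

  cramer₂ : ∀ e w m → proj₂ m * (e ∧ w) ≡ (m · w) * proj₁ e - (m · e) * proj₁ w
  cramer₂ (e₁ , e₂) (w₁ , w₂) (m₁ , m₂) = solve 6
    (λ e₁ e₂ w₁ w₂ m₁ m₂ → let e = (e₁ , e₂) ; w = (w₁ , w₂) ; m = (m₁ , m₂) in
       m₂ :* (e ∧ₚ w) := (m ·ₚ w) :* e₁ :- (m ·ₚ e) :* w₁)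
    refl e₁ e₂ w₁ w₂ m₁ m₂

  orthogonal-to-basis : ∀ e w m → ‖ e ‖² ≢ 0# → ‖ w ‖² ≢ 0# →
                        e · w ≡ 0# → m · e ≡ 0# → m · w ≡ 0# → m ≡ (0# , 0#)
  orthogonal-to-basis e w m ‖e‖²≢0 ‖w‖²≢0 e⊥w m⊥e m⊥w =
    cong₂ _,_ (cancel-nonzero (proj₁ m) (e ∧ w) (trans (cramer₁ e w m) (vanishing m⊥e m⊥w)) e∧w≢0)
              (cancel-nonzero (proj₂ m) (e ∧ w) (trans (cramer₂ e w m) (vanishing m⊥w m⊥e)) e∧w≢0)
    where
    o : ∀ {n} → Polynomial n
    o = con (+ 0)
    vanishing : ∀ {x y c d} → x ≡ 0# → y ≡ 0# → x * c - y * d ≡ 0#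
    vanishing {c = c} {d} refl refl = solve 2 (λ c d → o :* c :- o :* d := o) refl c d
    -- By Lagrange's identity (e ∧ w)² = ‖e‖² ‖w‖², so e and w are independent.
    e∧w≢0 : e ∧ w ≢ 0#
    e∧w≢0 e∧w≡0 = ‖e‖²≢0 (cancel-nonzero ‖ e ‖² ‖ w ‖² (begin
      ‖ e ‖² * ‖ w ‖²                        ≡⟨ lagrange e w ⟩
      (e · w) * (e · w) + (e ∧ w) * (e ∧ w)  ≡⟨ cong₂ (λ x y → x * x + y * y) e⊥w e∧w≡0 ⟩
      0# * 0# + 0# * 0#                      ≡⟨ solve 0 (o :* o :+ o :* o := o) refl ⟩
      0#                                     ∎) ‖w‖²≢0)

  module _ (X Y U V : Point ℝ) where
    open Quadrilateral X Y U V

    offset·diagonalXY : midpointOffset · diagonalXY + midpointOffset · diagonalXY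
                        ≡ (dist² ℝ U X + dist² ℝ V X) - (dist² ℝ U Y + dist² ℝ V Y)
    offset·diagonalXY = let (x₁ , x₂) = X ; (y₁ , y₂) = Y ; (u₁ , u₂) = U ; (v₁ , v₂) = V in solve 8
      (λ x₁ x₂ y₁ y₂ u₁ u₂ v₁ v₂ →
         let X = (x₁ , x₂) ; Y = (y₁ , y₂) ; U = (u₁ , u₂) ; V = (v₁ , v₂)
             module Q = Quadrilateralₚ X Y U V in
         Q.midpointOffset ·ₚ Q.diagonalXY :+ Q.midpointOffset ·ₚ Q.diagonalXY
           := (‖ U ⊖ₚ X ‖²ₚ :+ ‖ V ⊖ₚ X ‖²ₚ) :- (‖ U ⊖ₚ Y ‖²ₚ :+ ‖ V ⊖ₚ Y ‖²ₚ))
      refl x₁ x₂ y₁ y₂ u₁ u₂ v₁ v₂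

    diagonalXY·diagonalUV : diagonalXY · diagonalUV + diagonalXY · diagonalUV
                            ≡ (dist² ℝ U Y + dist² ℝ V X) - (dist² ℝ U X + dist² ℝ V Y)
    diagonalXY·diagonalUV = let (x₁ , x₂) = X ; (y₁ , y₂) = Y ; (u₁ , u₂) = U ; (v₁ , v₂) = V in solve 8
      (λ x₁ x₂ y₁ y₂ u₁ u₂ v₁ v₂ →
         let X = (x₁ , x₂) ; Y = (y₁ , y₂) ; U = (u₁ , u₂) ; V = (v₁ , v₂)
             module Q = Quadrilateralₚ X Y U V in
         Q.diagonalXY ·ₚ Q.diagonalUV :+ Q.diagonalXY ·ₚ Q.diagonalUV
           := (‖ U ⊖ₚ Y ‖²ₚ :+ ‖ V ⊖ₚ X ‖²ₚ) :- (‖ U ⊖ₚ X ‖²ₚ :+ ‖ V ⊖ₚ Y ‖²ₚ))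
      refl x₁ x₂ y₁ y₂ u₁ u₂ v₁ v₂

    offset·diagonalUV : midpointOffset · diagonalUV + midpointOffset · diagonalUV
                        ≡ (dist² ℝ V X + dist² ℝ V Y) - (dist² ℝ U X + dist² ℝ U Y)
    offset·diagonalUV = let (x₁ , x₂) = X ; (y₁ , y₂) = Y ; (u₁ , u₂) = U ; (v₁ , v₂) = V in solve 8
      (λ x₁ x₂ y₁ y₂ u₁ u₂ v₁ v₂ →
         let X = (x₁ , x₂) ; Y = (y₁ , y₂) ; U = (u₁ , u₂) ; V = (v₁ , v₂)
             module Q = Quadrilateralₚ X Y U V in
         Q.midpointOffset ·ₚ Q.diagonalUV :+ Q.midpointOffset ·ₚ Q.diagonalUV
           := (‖ V ⊖ₚ X ‖²ₚ :+ ‖ V ⊖ₚ Y ‖²ₚ) :- (‖ U ⊖ₚ X ‖²ₚ :+ ‖ U ⊖ₚ Y ‖²ₚ))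
      refl x₁ x₂ y₁ y₂ u₁ u₂ v₁ v₂

  rhombus : ∀ {d} X Y U V → dist² ℝ U X ≡ d → dist² ℝ U Y ≡ d →
            dist² ℝ V X ≡ d → dist² ℝ V Y ≡ d → X ≢ Y → U ≢ V → U ⊕ V ≡ X ⊕ Y
  rhombus X Y U V ux uy vx vy X≢Y U≢V =
    difference-zero (U ⊕ V) (X ⊕ Y)
      (orthogonal-to-basis diagonalXY diagonalUV midpointOffset
        (separated (λ Y≡X → X≢Y (sym Y≡X))) (separated (λ V≡U → U≢V (sym V≡U)))
        diagonals⊥ offset⊥XY offset⊥UV)
    where
    open Quadrilateral X Y U V
    balanced : ∀ {d a b c e} → a ≡ d → b ≡ d → c ≡ d → e ≡ d → (a + b) - (c + e) ≡ 0#
    balanced {d} refl refl refl refl = -‿inverseʳ (d + d)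

    diagonals⊥ : diagonalXY · diagonalUV ≡ 0#
    diagonals⊥ = double-zero _ (trans (diagonalXY·diagonalUV X Y U V) (balanced uy vx ux vy))

    offset⊥XY : midpointOffset · diagonalXY ≡ 0#
    offset⊥XY = double-zero _ (trans (offset·diagonalXY X Y U V) (balanced ux vx uy vy))

    offset⊥UV : midpointOffset · diagonalUV ≡ 0#
    offset⊥UV = double-zero _ (trans (offset·diagonalUV X Y U V) (balanced vx vy ux uy))

  opposite-vertex : ∀ {U V X Y} → U ⊕ V ≡ X ⊕ Y → V ≡ (X ⊕ Y) ⊖ U
  opposite-vertex U⊕V≡X⊕Y =
    cong₂ _,_ (solve-for (cong proj₁ U⊕V≡X⊕Y)) (solve-for (cong proj₂ U⊕V≡X⊕Y))
    where
    solve-for : ∀ {u v s} → u + v ≡ s → v ≡ s - u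
    solve-for {u} {v} refl = solve 2 (λ u v → v := (u :+ v) :- u) refl u v

  rhombus-chain : ∀ {a b c g s t u} → u ⊕ t ≡ a ⊕ b → b ⊕ s ≡ a ⊕ t → u ⊕ g ≡ c ⊕ a →
                  s ≡ (a ⊖ c) ⊕ g
  rhombus-chain {a} {b} {c} {g} {s} {t} {u} h₁ h₂ h₃ =
    cong₂ _,_ (coordinate (cong proj₁ t≡) (cong proj₁ s≡) (cong proj₁ g≡))
              (coordinate (cong proj₂ t≡) (cong proj₂ s≡) (cong proj₂ g≡))
    where
    t≡ : t ≡ (a ⊕ b) ⊖ u
    t≡ = opposite-vertex h₁
    s≡ : s ≡ (a ⊕ t) ⊖ b
    s≡ = opposite-vertex h₂
    g≡ : g ≡ (c ⊕ a) ⊖ u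
    g≡ = opposite-vertex h₃
    coordinate : ∀ {a b c g s t u} → t ≡ (a + b) - u → s ≡ (a + t) - b → g ≡ (c + a) - u →
                 s ≡ (a - c) + g
    coordinate {a} {b} {c} {u = u} refl refl refl = solve 4
      (λ a b c u → (a :+ ((a :+ b) :- u)) :- b := (a :- c) :+ ((c :+ a) :- u)) refl a b c u

  -- With all five squared distances equal to 1 it would read ‖v‖² + 9 = 6.
  obstruction-identity : ∀ a c g h →
    ‖ (a ⊕ a) ⊖ (c ⊕ h) ‖² + (6 × dist² ℝ c g + 3 × dist² ℝ c h)
      ≡ 2 × dist² ℝ ((a ⊖ c) ⊕ g) h + (2 × dist² ℝ a g + 2 × dist² ℝ c ((g ⊕ h) ⊖ c))
  obstruction-identity (a₁ , a₂) (c₁ , c₂) (g₁ , g₂) (h₁ , h₂) = solve 8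
    (λ a₁ a₂ c₁ c₂ g₁ g₂ h₁ h₂ →
       let a = (a₁ , a₂) ; c = (c₁ , c₂) ; g = (g₁ , g₂) ; h = (h₁ , h₂) in
       ‖ (a ⊕ₚ a) ⊖ₚ (c ⊕ₚ h) ‖²ₚ :+ (6 :× ‖ c ⊖ₚ g ‖²ₚ :+ 3 :× ‖ c ⊖ₚ h ‖²ₚ)
         := 2 :× ‖ ((a ⊖ₚ c) ⊕ₚ g) ⊖ₚ h ‖²ₚ
              :+ (2 :× ‖ a ⊖ₚ g ‖²ₚ :+ 2 :× ‖ c ⊖ₚ ((g ⊕ₚ h) ⊖ₚ c) ‖²ₚ))
    refl a₁ a₂ c₁ c₂ g₁ g₂ h₁ h₂

  unit-obstruction : ∀ a c g h → dist² ℝ a g ≡ 1# → dist² ℝ c g ≡ 1# → dist² ℝ c h ≡ 1# →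
                     dist² ℝ c ((g ⊕ h) ⊖ c) ≡ 1# → dist² ℝ ((a ⊖ c) ⊕ g) h ≡ 1# → ⊥
  unit-obstruction a c g h ag cg ch ck mh = positive-shift 0<3+‖v‖² (begin
    (3 × 1# + ‖ v ‖²) + six                        ≡⟨ numerals ‖ v ‖² ⟨
    ‖ v ‖² + (6 × 1# + 3 × 1#)                     ≡⟨ cong₂ (λ x y → ‖ v ‖² + (6 × x + 3 × y)) cg ch ⟨
    ‖ v ‖² + (6 × dist² ℝ c g + 3 × dist² ℝ c h)   ≡⟨ obstruction-identity a c g h ⟩
    2 × dist² ℝ m h + (2 × dist² ℝ a g + 2 × dist² ℝ c k)
                                                   ≡⟨ cong₂ (λ x y → 2 × x + (2 × y + 2 × dist² ℝ c k)) mh ag ⟩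
    2 × 1# + (2 × 1# + 2 × dist² ℝ c k)            ≡⟨ cong (λ x → 2 × 1# + (2 × 1# + 2 × x)) ck ⟩
    six                                            ∎)
    where
    v m k : Point ℝ
    v = (a ⊕ a) ⊖ (c ⊕ h)
    m = (a ⊖ c) ⊕ g
    k = (g ⊕ h) ⊖ c
    six : R
    six = 2 × 1# + (2 × 1# + 2 × 1#)
    numerals : ∀ x → x + (6 × 1# + 3 × 1#) ≡ (3 × 1# + x) + six
    numerals = solve 1 (λ x → x :+ (con (+ 6) :+ con (+ 3))
                              := (con (+ 3) :+ x) :+ (con (+ 2) :+ (con (+ 2) :+ con (+ 2)))) refl
    0<3+‖v‖² : 0# < 3 × 1# + ‖ v ‖²
    0<3+‖v‖² = +-pos (multiple-pos 2) (norm-nonneg v)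

module UnitDistanceEmbedding (ℝ : RealField) {n} (G : Graph n) (φ : Fin n → Point ℝ)
                             (embedding : IsUnitDistanceEmbedding ℝ G φ) where
  open RealField ℝ using (1#)
  open PlaneGeometry ℝ using (dist²-sym; rhombus; _⊕_)
  open import Data.List.Membership.DecPropositional (ProdP.≡-dec (Fin._≟_ {n}) (Fin._≟_ {n}))
    using (_∈?_)

  edge? : ∀ v w → Dec ((v , w) ∈ Graph.edges G ⊎ (w , v) ∈ Graph.edges G)
  edge? v w = (v , w) ∈? Graph.edges G ⊎-dec (w , v) ∈? Graph.edges G

  adjacent : ∀ v w → {True (edge? v w)} → dist² ℝ (φ v) (φ w) ≡ 1#
  adjacent v w {edge} with toWitness {a? = edge? v w} edge
  ... | inj₁ vw = proj₂ embedding vw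
  ... | inj₂ wv = trans (dist²-sym (φ v) (φ w)) (proj₂ embedding wv)

  distinct : ∀ {v w} → v ≢ w → φ v ≢ φ w
  distinct v≢w φv≡φw = v≢w (proj₁ embedding φv≡φw)

  four-cycle : ∀ x y u v → {True (edge? u x)} → {True (edge? u y)} →
               {True (edge? v x)} → {True (edge? v y)} →
               {False (x Fin.≟ y)} → {False (u Fin.≟ v)} → φ u ⊕ φ v ≡ φ x ⊕ φ y
  four-cycle x y u v {ux} {uy} {vx} {vy} {x≢y} {u≢v} =
    rhombus (φ x) (φ y) (φ u) (φ v)
      (adjacent u x {ux}) (adjacent u y {uy}) (adjacent v x {vx}) (adjacent v y {vy})
      (distinct (toWitnessFalse x≢y)) (distinct (toWitnessFalse u≢v))

-- The 4-cycles 1 0 2 7, 1 2 7 6, 3 0 1 4 and 3 4 5 8 are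
-- mapped to rhombi, which place vertex 5 at g + h - c and vertex 6 at
-- a - c + g, where a, c, g, h are the images of 1, 3, 4, 8; the unit
-- edges 1–4, 3–4, 3–8, 3–5 and 6–8 then contradict unit-obstruction.

mainTheorem17 : (ℝ : RealField) → Forbidden ℝ F-9-15-22
mainTheorem17 ℝ (φ , embedding) =
  unit-obstruction (φ 1F) (φ 3F) (φ 4F) (φ 8F) (adjacent 1F 4F) (adjacent 3F 4F) (adjacent 3F 8F)
    (subst (λ P → dist² ℝ (φ 3F) P ≡ 1#) vertex5 (adjacent 3F 5F))
    (subst (λ P → dist² ℝ P (φ 8F) ≡ 1#) vertex6 (adjacent 6F 8F))
  where
  open RealField ℝ using (1#)
  open PlaneGeometry ℝ
  open UnitDistanceEmbedding ℝ F-9-15-22 φ embedding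

  vertex5 : φ 5F ≡ (φ 4F ⊕ φ 8F) ⊖ φ 3F
  vertex5 = opposite-vertex (sym (four-cycle 3F 5F 4F 8F))
  vertex6 : φ 6F ≡ (φ 1F ⊖ φ 3F) ⊕ φ 4F
  vertex6 = rhombus-chain (four-cycle 1F 2F 0F 7F) (four-cycle 1F 7F 2F 6F) (four-cycle 3F 1F 0F 4F)
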